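{- For every integer $n\geq 1$ there is a Boolean network $f:\{0,1\}^n\to\{0,1\}^n$ such that every digraph in $\mathcal{G}(f)$ has at least $n^2/9$ arcs.
   Context: A Boolean network with $n$ components is a map $f:\{0,1\}^n\to\{0,1\}^n$, $x\mapsto(f_1(x),\dots,f_n(x))$. For $i\in[n]=\{1,\dots,n\}$, $e_i$ denotes the configuration with a $1$ exactly in component $i$, and $x+y$ denotes componentwise addition modulo 2. The interaction graph $G(f)$ is the digraph with vertex set $[n]$ having an arc from $j$ to $i$ (loops $i=j$ allowed) if and only if there is $x\in\{0,1\}^n$ with $f_i(x)\neq f_i(x+e_j)$. Two networks $f,h$ with $n$ components are isomorphic if $h\circ\pi=\pi\circ f$ for some permutation $\pi$ of $\{0,1\}^n$. $\mathcal{G}(f)$ is the set of interaction graphs $G(h)$ of all networks $h$ isomorphic to $f$. -}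

module Defs where

open import Data.Nat using (ℕ; zero; suc; _+_; _*_)
open import Data.Bool using (Bool; true; false; not; _∧_; _∨_)
open import Data.Vec using (Vec; []; _∷_; lookup; updateAt)
open import Data.Fin using (Fin)
open import Data.List using (List; []; _∷_; map; _++_; concatMap; allFin; length; filter)
open import Data.Bool.ListAction using (any)
open import Function.Bundles using (_↔_; Inverse)
open import Relation.Binary.PropositionalEquality using (_≡_)

Config : ℕ → Set
Config n = Vec Bool n

BN : ℕ → Set
BN n = Config n → Config n

flip : ∀ {n} → Config n → Fin n → Config n
flip x j = updateAt x j not

_≠ᵇ_ : Bool → Bool → Bool
true  ≠ᵇ b = not b
false ≠ᵇ b = b

allConfigs : (n : ℕ) → List (Config n)
allConfigs zero    = [] ∷ []
allConfigs (suc n) = map (false ∷_) (allConfigs n) ++ map (true ∷_) (allConfigs n)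

arc? : ∀ {n} → BN n → Fin n → Fin n → Bool
arc? {n} f j i = any (λ x → lookup (f x) i ≠ᵇ lookup (f (flip x j)) i) (allConfigs n)

-- Number of arcs of G(f) (loops included).
numArcs : ∀ {n} → BN n → ℕ
numArcs {n} f =
  length (filter (λ p → Data.Bool._≟_ (arc? f (Data.Product.proj₁ p) (Data.Product.proj₂ p)) true)
                 (concatMap (λ j → map (λ i → j Data.Product., i) (allFin n)) (allFin n)))
  where import Data.Bool
        import Data.Product

Isomorphic : ∀ {n} → BN n → BN n → Set
Isomorphic {n} f h =
  Σ (Config n ↔ Config n) λ π →
    ∀ x → h (Inverse.to π x) ≡ Inverse.to π (f x)
  where open import Data.Product using (Σ)

-- Let f fix every configuration supported in a set S of k coordinates and send all
-- others to 0, and let h ∘ π = π ∘ f. Then h fixes the 2^k points of the image of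
-- the subcube and sends everything else to Z = π 0. For each component i, the set
-- where h_i differs from Z_i has fewer than 2^k points and is closed under flipping
-- any of the n - d_i non-inputs of i, so it is empty unless d_i > n - k. The
-- components where it is empty are constant on the image of the subcube, which has
-- 2^k points, so at least k components have in-degree above n - k: G(h) has at least
-- k (n - k + 1) arcs, which is at least n²/9 for k = ⌈n/2⌉.

module Submission where

open import Defs
open import Data.Bool using (Bool; true; false; not; _∧_; if_then_else_; T; _≟_)
open import Data.Bool.Properties using (∧-conicalˡ)
open import Data.Empty using (⊥-elim)
open import Data.Fin using (Fin; zero; suc)
open import Data.Fin.Subset using (Subset; inside; outside; _∈_; _∉_; ∁; ∣_∣; ⊥)
open import Data.Fin.Subset.Properties using (drop-there; x∈∁p⇒x∉p; ∣∁p∣≡n∸∣p∣; ∣⊥∣≡0; ∣p∣≤n)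
open import Data.List using (List; map; filter; length; concatMap; allFin)
import Data.List as List
open import Data.List.Properties using (map-++; map-∘; map-tabulate; filter-++; length-++)
open import Data.List.Membership.Propositional using () renaming (_∈_ to _∈ₗ_)
open import Data.List.Membership.Propositional.Properties using (∈-map⁺; ∈-map⁻; ∈-++⁺ˡ; ∈-++⁺ʳ)
open import Data.List.Membership.Propositional.Properties.WithK using (unique∧set⇒bag)
open import Data.List.Relation.Binary.BagAndSetEquality using (∼bag⇒↭)
open import Data.List.Relation.Binary.Permutation.Propositional using (_↭_)
import Data.List.Relation.Binary.Permutation.Propositional.Properties as ↭
import Data.List.Relation.Unary.All as All
import Data.List.Relation.Unary.AllPairs as AllPairs
import Data.List.Relation.Unary.Any as Any
open import Data.List.Relation.Unary.Any.Properties using (any⁺)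
open import Data.List.Relation.Unary.Unique.Propositional using (Unique)
import Data.List.Relation.Unary.Unique.Propositional.Properties as Unique
open import Data.Nat using (ℕ; zero; suc; _+_; _*_; _∸_; _^_; _≤_; _<_; _≥_; _≤ᵇ_; z≤n; s≤s; ⌊_/2⌋; ⌈_/2⌉)
open import Data.Nat.Divisibility using (_∣_; 1∣_; ∣⇒≤; ∣m∣n⇒∣m+n; *-monoʳ-∣)
open import Data.Nat.ListAction using () renaming (sum to sumₗ)
open import Data.Nat.ListAction.Properties using (sum-++; sum-↭)
open import Data.Nat.Properties hiding (_≟_)
open import Data.Nat.Tactic.RingSolver using (solve-∀)
open import Data.Product using (Σ; ∃; _,_; _×_; proj₁; proj₂)
open import Data.Unit using (tt)
open import Data.Vec using ([]; _∷_; here; there; lookup; tabulate; replicate)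
import Data.Vec.Properties as Vec
open import Function using (_∘_)
open import Function.Bundles using (_↔_; Inverse; Injection; mk⇔)
open import Function.Properties.Inverse using (↔⇒↣)
open import Relation.Binary.PropositionalEquality
open import Relation.Nullary using (¬_; contradiction; ofʸ; ofⁿ)
open import Relation.Unary using (Decidable)
open import Algebra.Properties.CommutativeMonoid.Sum +-0-commutativeMonoid using (sum-syntax; ∑-comm; sum-cong-≗)

toℕ : Bool → ℕ
toℕ false = 0
toℕ true  = 1

≠ᵇ-refl : ∀ b → b ≠ᵇ b ≡ false
≠ᵇ-refl false = refl
≠ᵇ-refl true  = refl

≠ᵇ-false⇒≡ : ∀ {b c} → b ≠ᵇ c ≡ false → b ≡ c
≠ᵇ-false⇒≡ {false} {false} _ = refl
≠ᵇ-false⇒≡ {true}  {true}  _ = refl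

count : ∀ {n} → (Config n → Bool) → ℕ
count {zero}  P = toℕ (P [])
count {suc n} P = count (P ∘ (false ∷_)) + count (P ∘ (true ∷_))

_⊆ᵇ_ : ∀ {n} → (Config n → Bool) → (Config n → Bool) → Set
P ⊆ᵇ Q = ∀ x → P x ≡ true → Q x ≡ true

count-cong : ∀ {n} {P Q : Config n → Bool} → (∀ x → P x ≡ Q x) → count P ≡ count Q
count-cong {zero}  P≗Q = cong toℕ (P≗Q [])
count-cong {suc n} P≗Q = cong₂ _+_ (count-cong (P≗Q ∘ (false ∷_))) (count-cong (P≗Q ∘ (true ∷_)))

count-const-false : ∀ n → count {n} (λ _ → false) ≡ 0
count-const-false zero    = refl
count-const-false (suc n) = cong₂ _+_ (count-const-false n) (count-const-false n)

toℕ-mono : ∀ {b c} → (b ≡ true → c ≡ true) → toℕ b ≤ toℕ c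
toℕ-mono {false} _   = z≤n
toℕ-mono {true}  b⇒c rewrite b⇒c refl = ≤-refl

count-mono : ∀ {n} {P Q : Config n → Bool} → P ⊆ᵇ Q → count P ≤ count Q
count-mono {zero}  P⊆Q = toℕ-mono (P⊆Q [])
count-mono {suc n} P⊆Q = +-mono-≤ (count-mono (P⊆Q ∘ (false ∷_))) (count-mono (P⊆Q ∘ (true ∷_)))

count-< : ∀ {n} {P Q : Config n → Bool} → P ⊆ᵇ Q →
          ∀ w → P w ≡ false → Q w ≡ true → count P < count Q
count-< {zero}  _   [] Pw Qw rewrite Pw | Qw = s≤s z≤n
count-< {suc n} P⊆Q (false ∷ w) Pw Qw =
  +-mono-<-≤ (count-< (P⊆Q ∘ (false ∷_)) w Pw Qw) (count-mono (P⊆Q ∘ (true ∷_)))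
count-< {suc n} P⊆Q (true ∷ w) Pw Qw =
  +-mono-≤-< (count-mono (P⊆Q ∘ (false ∷_))) (count-< (P⊆Q ∘ (true ∷_)) w Pw Qw)

count≡0⇒false : ∀ {n} {P : Config n → Bool} → count P ≡ 0 → ∀ w → P w ≡ false
count≡0⇒false {zero} {P} #P≡0 [] with P []
... | false = refl
count≡0⇒false {suc n} #P≡0 (false ∷ w) = count≡0⇒false (m+n≡0⇒m≡0 _ #P≡0) w
count≡0⇒false {suc n} #P≡0 (true ∷ w) = count≡0⇒false (m+n≡0⇒n≡0 _ #P≡0) w

count-divisible : ∀ {n} (S : Subset n) {P : Config n → Bool} →
                  (∀ x {j} → j ∈ S → P (flip x j) ≡ P x) → 2 ^ ∣ S ∣ ∣ count P
count-divisible [] _ = 1∣ _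
count-divisible (outside ∷ S) inv =
  ∣m∣n⇒∣m+n (count-divisible S (λ x j∈S → inv (false ∷ x) (there j∈S)))
            (count-divisible S (λ x j∈S → inv (true ∷ x) (there j∈S)))
count-divisible (inside ∷ S) {P} inv =
  subst (2 ^ suc ∣ S ∣ ∣_) (sym double)
        (*-monoʳ-∣ 2 (count-divisible S (λ x j∈S → inv (false ∷ x) (there j∈S))))
  where
  P₀ : Config _ → Bool
  P₀ = P ∘ (false ∷_)
  double : count P ≡ 2 * count P₀
  double = begin
    count P₀ + count (P ∘ (true ∷_))  ≡⟨ cong (count P₀ +_) (count-cong (λ x → inv (false ∷ x) here)) ⟩
    count P₀ + count P₀              ≡⟨ cong (count P₀ +_) (+-identityʳ (count P₀)) ⟨
    2 * count P₀                     ∎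
    where open ≡-Reasoning

agreesOutside : ∀ {n} → Subset n → Config n → Config n → Bool
agreesOutside []            []      []      = true
agreesOutside (inside  ∷ S) (_ ∷ z) (_ ∷ y) = agreesOutside S z y
agreesOutside (outside ∷ S) (b ∷ z) (c ∷ y) = not (b ≠ᵇ c) ∧ agreesOutside S z y

count-agreesOutside : ∀ {n} (S : Subset n) (z : Config n) → count (agreesOutside S z) ≡ 2 ^ ∣ S ∣
count-agreesOutside [] [] = refl
count-agreesOutside (inside ∷ S) (_ ∷ z) =
  cong₂ _+_ (count-agreesOutside S z) (trans (count-agreesOutside S z) (sym (+-identityʳ _)))
count-agreesOutside {suc n} (outside ∷ S) (false ∷ z) =
  trans (cong₂ _+_ (count-agreesOutside S z) (count-const-false n)) (+-identityʳ _)
count-agreesOutside {suc n} (outside ∷ S) (true ∷ z) =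
  cong₂ _+_ (count-const-false n) (count-agreesOutside S z)

agreesOutside-intro : ∀ {n} (S : Subset n) (z y : Config n) →
                      (∀ i → i ∉ S → lookup y i ≡ lookup z i) → agreesOutside S z y ≡ true
agreesOutside-intro [] [] [] _ = refl
agreesOutside-intro (inside ∷ S) (_ ∷ z) (_ ∷ y) agree =
  agreesOutside-intro S z y (λ i i∉S → agree (suc i) (i∉S ∘ drop-there))
agreesOutside-intro (outside ∷ S) (b ∷ z) (c ∷ y) agree
  rewrite agree zero (λ ()) | ≠ᵇ-refl b =
  agreesOutside-intro S z y (λ i i∉S → agree (suc i) (i∉S ∘ drop-there))

allConfigs-complete : ∀ {n} (x : Config n) → x ∈ₗ allConfigs n
allConfigs-complete [] = Any.here refl
allConfigs-complete {suc n} (false ∷ x) = ∈-++⁺ˡ (∈-map⁺ (false ∷_) (allConfigs-complete x))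
allConfigs-complete {suc n} (true ∷ x) =
  ∈-++⁺ʳ (map (false ∷_) (allConfigs n)) (∈-map⁺ (true ∷_) (allConfigs-complete x))

allConfigs-unique : ∀ n → Unique (allConfigs n)
allConfigs-unique zero = All.[] AllPairs.∷ AllPairs.[]
allConfigs-unique (suc n) =
  Unique.++⁺ (Unique.map⁺ Vec.∷-injectiveʳ (allConfigs-unique n))
             (Unique.map⁺ Vec.∷-injectiveʳ (allConfigs-unique n))
             disjoint
  where
  disjoint : ∀ {v} → ¬ (v ∈ₗ map (false ∷_) (allConfigs n) × v ∈ₗ map (true ∷_) (allConfigs n))
  disjoint (p , q) with ∈-map⁻ (false ∷_) p | ∈-map⁻ (true ∷_) q
  ... | _ , _ , refl | _ , _ , ()

count≡sum : ∀ {n} (P : Config n → Bool) → count P ≡ sumₗ (map (toℕ ∘ P) (allConfigs n))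
count≡sum {zero} P = sym (+-identityʳ _)
count≡sum {suc n} P = begin
  count (P ∘ (false ∷_)) + count (P ∘ (true ∷_))
    ≡⟨ cong₂ _+_ (count≡sum (P ∘ (false ∷_))) (count≡sum (P ∘ (true ∷_))) ⟩
  sumₗ (map (toℕ ∘ P ∘ (false ∷_)) xs) + sumₗ (map (toℕ ∘ P ∘ (true ∷_)) xs)
    ≡⟨ cong₂ (λ a b → sumₗ a + sumₗ b) (map-∘ xs) (map-∘ xs) ⟩
  sumₗ (map (toℕ ∘ P) (map (false ∷_) xs)) + sumₗ (map (toℕ ∘ P) (map (true ∷_) xs))
    ≡⟨ sum-++ (map (toℕ ∘ P) (map (false ∷_) xs)) _ ⟨
  sumₗ (map (toℕ ∘ P) (map (false ∷_) xs) List.++ map (toℕ ∘ P) (map (true ∷_) xs))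
    ≡⟨ cong sumₗ (sym (map-++ (toℕ ∘ P) (map (false ∷_) xs) _)) ⟩
  sumₗ (map (toℕ ∘ P) (allConfigs (suc n))) ∎
  where open ≡-Reasoning
        xs = allConfigs n

map-allConfigs-↭ : ∀ {n} (π : Config n ↔ Config n) → map (Inverse.to π) (allConfigs n) ↭ allConfigs n
map-allConfigs-↭ {n} π = ∼bag⇒↭ (unique∧set⇒bag
  (Unique.map⁺ (Injection.injective (↔⇒↣ π)) (allConfigs-unique n)) (allConfigs-unique n)
  (λ {x} → mk⇔ (λ _ → allConfigs-complete x)
       (λ _ → subst (_∈ₗ map (Inverse.to π) (allConfigs n)) (Inverse.strictlyInverseˡ π x)
                        (∈-map⁺ (Inverse.to π) (allConfigs-complete _)))))

count-∘-↔ : ∀ {n} (π : Config n ↔ Config n) (P : Config n → Bool) → count (P ∘ Inverse.to π) ≡ count P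
count-∘-↔ {n} π P = begin
  count (P ∘ to)                               ≡⟨ count≡sum (P ∘ to) ⟩
  sumₗ (map (toℕ ∘ P ∘ to) (allConfigs n))      ≡⟨ cong sumₗ (map-∘ (allConfigs n)) ⟩
  sumₗ (map (toℕ ∘ P) (map to (allConfigs n)))  ≡⟨ sum-↭ (↭.map⁺ (toℕ ∘ P) (map-allConfigs-↭ π)) ⟩
  sumₗ (map (toℕ ∘ P) (allConfigs n))           ≡⟨ count≡sum P ⟨
  count P ∎
  where open ≡-Reasoning
        open Inverse π using (to)

inputs : ∀ {n} → BN n → Fin n → Subset n
inputs f i = tabulate (λ j → arc? f j i)

indegree : ∀ {n} → BN n → Fin n → ℕ
indegree f i = ∣ inputs f i ∣

∉-tabulate⇒false : ∀ {n} {g : Fin n → Bool} {i} → i ∉ tabulate g → g i ≡ false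
∉-tabulate⇒false {g = g} {i} i∉g with g i in gi
... | false = refl
... | true  = contradiction (Vec.lookup⇒[]= i (tabulate g) (trans (Vec.lookup∘tabulate g i) gi)) i∉g

¬arc⇒insensitive : ∀ {n} (f : BN n) {j i} → arc? f j i ≡ false →
                   ∀ x → lookup (f (flip x j)) i ≡ lookup (f x) i
¬arc⇒insensitive f {j} {i} no-arc x with lookup (f x) i ≠ᵇ lookup (f (flip x j)) i in differs
... | false = sym (≠ᵇ-false⇒≡ differs)
... | true  = ⊥-elim (subst T no-arc (any⁺ _ witness))
  where
  witness : Any.Any (λ y → T (lookup (f y) i ≠ᵇ lookup (f (flip y j)) i)) (allConfigs _)
  witness = Any.map (λ { refl → subst T (sym differs) tt }) (allConfigs-complete x)

module _ {A B : Set} {P : B → Set} (P? : Decidable P) where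

  length-filter-concatMap : ∀ {n} (g : Fin n → A) (f : A → List B) →
    length (filter P? (concatMap f (List.tabulate g))) ≡ ∑[ j < n ] length (filter P? (f (g j)))
  length-filter-concatMap {zero}  g f = refl
  length-filter-concatMap {suc n} g f = begin
    length (filter P? (f (g zero) List.++ concatMap f (List.tabulate (g ∘ suc))))
      ≡⟨ cong length (filter-++ P? (f (g zero)) _) ⟩
    length (filter P? (f (g zero)) List.++ filter P? (concatMap f (List.tabulate (g ∘ suc))))
      ≡⟨ length-++ (filter P? (f (g zero))) ⟩
    length (filter P? (f (g zero))) + length (filter P? (concatMap f (List.tabulate (g ∘ suc))))
      ≡⟨ cong (length (filter P? (f (g zero))) +_) (length-filter-concatMap (g ∘ suc) f) ⟩
    ∑[ j < suc n ] length (filter P? (f (g j))) ∎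
    where open ≡-Reasoning

length-filter-tabulate : ∀ {A : Set} (p : A → Bool) {n} (g : Fin n → A) →
  length (filter (λ x → p x ≟ true) (List.tabulate g)) ≡ ∣ tabulate (p ∘ g) ∣
length-filter-tabulate p {zero}  g = refl
length-filter-tabulate p {suc n} g with p (g zero)
... | true  = cong suc (length-filter-tabulate p (g ∘ suc))
... | false = length-filter-tabulate p (g ∘ suc)

∣tabulate∣≡∑ : ∀ {n} (g : Fin n → Bool) → ∣ tabulate g ∣ ≡ ∑[ i < n ] toℕ (g i)
∣tabulate∣≡∑ {zero}  g = refl
∣tabulate∣≡∑ {suc n} g with g zero
... | true  = cong suc (∣tabulate∣≡∑ (g ∘ suc))
... | false = ∣tabulate∣≡∑ (g ∘ suc)

numArcs≡∑indegree : ∀ {n} (f : BN n) → numArcs f ≡ ∑[ i < n ] indegree f i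
numArcs≡∑indegree {n} f = begin
  numArcs f
    ≡⟨ length-filter-concatMap isArc? (λ j → j) (λ j → map (j ,_) (allFin n)) ⟩
  ∑[ j < n ] length (filter isArc? (map (j ,_) (allFin n)))
    ≡⟨ sum-cong-≗ outdegree ⟩
  ∑[ j < n ] ∣ tabulate (arc? f j) ∣
    ≡⟨ sum-cong-≗ (λ j → ∣tabulate∣≡∑ (arc? f j)) ⟩
  ∑[ j < n ] ∑[ i < n ] toℕ (arc? f j i)
    ≡⟨ ∑-comm (λ j i → toℕ (arc? f j i)) ⟩
  ∑[ i < n ] ∑[ j < n ] toℕ (arc? f j i)
    ≡⟨ sum-cong-≗ (λ i → ∣tabulate∣≡∑ (λ j → arc? f j i)) ⟨
  ∑[ i < n ] indegree f i ∎
  where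
  open ≡-Reasoning
  arc : Fin n × Fin n → Bool
  arc (j , i) = arc? f j i
  isArc? : Decidable (λ q → arc q ≡ true)
  isArc? q = arc q ≟ true
  outdegree : ∀ j → length (filter isArc? (map (j ,_) (allFin n))) ≡ ∣ tabulate (arc? f j) ∣
  outdegree j = trans (cong (length ∘ filter isArc?) (map-tabulate (λ i → i) (j ,_)))
                      (length-filter-tabulate arc (j ,_))

m∣n∧n<m⇒n≡0 : ∀ {m n} → m ∣ n → n < m → n ≡ 0
m∣n∧n<m⇒n≡0 {n = zero}  _   _   = refl
m∣n∧n<m⇒n≡0 {n = suc _} m∣n n<m = contradiction (∣⇒≤ m∣n) (<⇒≱ n<m)

∣threshold∣*c≤∑ : ∀ {n} c (f : Fin n → ℕ) → ∣ tabulate (λ i → c ≤ᵇ f i) ∣ * c ≤ ∑[ i < n ] f i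
∣threshold∣*c≤∑ {zero}  c f = z≤n
∣threshold∣*c≤∑ {suc n} c f with c ≤ᵇ f zero | ≤ᵇ-reflects-≤ c (f zero)
... | true  | ofʸ c≤f₀ = +-mono-≤ c≤f₀ (∣threshold∣*c≤∑ c (f ∘ suc))
... | false | ofⁿ _    = ≤-trans (∣threshold∣*c≤∑ c (f ∘ suc)) (m≤n+m _ (f zero))

subset-of-size : ∀ {k n} → k ≤ n → ∃ λ (S : Subset n) → ∣ S ∣ ≡ k
subset-of-size {n = n} z≤n = ⊥ , ∣⊥∣≡0 n
subset-of-size (s≤s k≤n) with S , ∣S∣≡k ← subset-of-size k≤n = inside ∷ S , cong suc ∣S∣≡k

count-component-divisible : ∀ {n} (f : BN n) (i : Fin n) (g : Bool → Bool) →
                            2 ^ (n ∸ indegree f i) ∣ count (λ x → g (lookup (f x) i))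
count-component-divisible f i g =
  subst (λ s → 2 ^ s ∣ count (λ x → g (lookup (f x) i))) (∣∁p∣≡n∸∣p∣ (inputs f i))
        (count-divisible (∁ (inputs f i))
           (λ x j∈∁ → cong g (¬arc⇒insensitive f (∉-tabulate⇒false (x∈∁p⇒x∉p j∈∁)) x)))

zeros : ∀ {n} → Config n
zeros = replicate _ false

subcube : ∀ {n} → Subset n → Config n → Bool
subcube S = agreesOutside S zeros

retraction : ∀ {n} → Subset n → BN n
retraction S x = if subcube S x then x else zeros

module ConjugateOfRetraction {n} (S : Subset n) (h : BN n) (iso : Isomorphic (retraction S) h) where

  π = proj₁ iso
  open Inverse π using (to)

  k : ℕ
  k = ∣ S ∣

  Z : Config n
  Z = to zeros

  deviates : Fin n → Config n → Bool
  deviates i x = lookup (h x) i ≠ᵇ lookup Z i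

  deviatesOnSubcube : Fin n → Config n → Bool
  deviatesOnSubcube i w = subcube S w ∧ (lookup (to w) i ≠ᵇ lookup Z i)

  deviates∘to : ∀ i w → deviates i (to w) ≡ deviatesOnSubcube i w
  deviates∘to i w rewrite proj₂ iso w with subcube S w
  ... | true  = refl
  ... | false = ≠ᵇ-refl (lookup Z i)

  count-deviates : ∀ i → count (deviates i) ≡ count (deviatesOnSubcube i)
  count-deviates i = trans (sym (count-∘-↔ π (deviates i))) (count-cong (deviates∘to i))

  count-deviates<2^k : ∀ i → count (deviates i) < 2 ^ k
  count-deviates<2^k i = begin-strict
    count (deviates i)           ≡⟨ count-deviates i ⟩
    count (deviatesOnSubcube i)  <⟨ count-< deviates⊆subcube zeros zeros-conforms zeros∈subcube ⟩
    count (subcube S)            ≡⟨ count-agreesOutside S zeros ⟩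
    2 ^ k                        ∎
    where
    open ≤-Reasoning
    deviates⊆subcube : deviatesOnSubcube i ⊆ᵇ subcube S
    deviates⊆subcube w = ∧-conicalˡ (subcube S w) _
    zeros∈subcube : subcube S zeros ≡ true
    zeros∈subcube = agreesOutside-intro S zeros zeros (λ _ _ → refl)
    zeros-conforms : deviatesOnSubcube i zeros ≡ false
    zeros-conforms rewrite zeros∈subcube = ≠ᵇ-refl (lookup Z i)

  low-indegree⇒conforms : ∀ i → indegree h i ≤ n ∸ k →
                          ∀ w → subcube S w ≡ true → lookup (to w) i ≡ lookup Z i
  low-indegree⇒conforms i low w w∈subcube =
    ≠ᵇ-false⇒≡ (subst (λ b → b ∧ (lookup (to w) i ≠ᵇ lookup Z i) ≡ false) w∈subcube never)
    where
    k≤noninputs : k ≤ n ∸ indegree h i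
    k≤noninputs = subst (_≤ n ∸ indegree h i) (m∸[m∸n]≡n (∣p∣≤n S)) (∸-monoʳ-≤ n low)
    no-deviations : count (deviates i) ≡ 0
    no-deviations = m∣n∧n<m⇒n≡0 (count-component-divisible h i (_≠ᵇ lookup Z i))
                      (<-≤-trans (count-deviates<2^k i) (^-monoʳ-≤ 2 k≤noninputs))
    never : deviatesOnSubcube i w ≡ false
    never = count≡0⇒false (trans (sym (count-deviates i)) no-deviations) w

  large : Subset n
  large = tabulate (λ i → suc (n ∸ k) ≤ᵇ indegree h i)

  k≤∣large∣ : k ≤ ∣ large ∣
  k≤∣large∣ = ^-reflectsʳ-≤ (begin
    2 ^ k                                  ≡⟨ count-agreesOutside S zeros ⟨
    count (subcube S)                      ≤⟨ count-mono subcube⊆ ⟩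
    count (agreesOutside large Z ∘ to)     ≡⟨ count-∘-↔ π (agreesOutside large Z) ⟩
    count (agreesOutside large Z)          ≡⟨ count-agreesOutside large Z ⟩
    2 ^ ∣ large ∣                          ∎)
    where
    open ≤-Reasoning
    ^-reflectsʳ-≤ : ∀ {a b} → 2 ^ a ≤ 2 ^ b → a ≤ b
    ^-reflectsʳ-≤ 2^a≤2^b = ≮⇒≥ (λ b<a → <⇒≱ (^-monoʳ-< 2 (s≤s (s≤s z≤n)) b<a) 2^a≤2^b)
    small⇒low : ∀ {i} → i ∉ large → indegree h i ≤ n ∸ k
    small⇒low i∉large = ≮⇒≥ (λ high → subst T (∉-tabulate⇒false i∉large) (≤⇒≤ᵇ high))
    subcube⊆ : subcube S ⊆ᵇ (agreesOutside large Z ∘ to)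
    subcube⊆ w w∈subcube = agreesOutside-intro large Z (to w)
      (λ i i∉large → low-indegree⇒conforms i (small⇒low i∉large) w w∈subcube)

  k*[1+n∸k]≤numArcs : k * suc (n ∸ k) ≤ numArcs h
  k*[1+n∸k]≤numArcs = begin
    k * suc (n ∸ k)            ≤⟨ *-monoˡ-≤ (suc (n ∸ k)) k≤∣large∣ ⟩
    ∣ large ∣ * suc (n ∸ k)    ≤⟨ ∣threshold∣*c≤∑ (suc (n ∸ k)) (indegree h) ⟩
    ∑[ i < n ] indegree h i    ≡⟨ numArcs≡∑indegree h ⟨
    numArcs h                  ∎
    where open ≤-Reasoning

n²≤9*⌈n/2⌉*[1+n∸⌈n/2⌉] : ∀ n → n * n ≤ 9 * (⌈ n /2⌉ * suc (n ∸ ⌈ n /2⌉))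
n²≤9*⌈n/2⌉*[1+n∸⌈n/2⌉] n = begin
  n * n               ≤⟨ *-mono-≤ n≤k+k n≤k+k ⟩
  (k + k) * (k + k)   ≡⟨ square-double k ⟩
  4 * (k * k)         ≤⟨ *-monoʳ-≤ 4 (*-monoʳ-≤ k k≤1+a) ⟩
  4 * (k * suc a)     ≤⟨ *-monoˡ-≤ (k * suc a) {4} {9} (s≤s (s≤s (s≤s (s≤s z≤n)))) ⟩
  9 * (k * suc a)     ≡⟨ cong (λ m → 9 * (k * suc m)) n∸k≡a ⟨
  9 * (k * suc (n ∸ k)) ∎
  where
  open ≤-Reasoning
  a k : ℕ
  a = ⌊ n /2⌋
  k = ⌈ n /2⌉
  a+k≡n : a + k ≡ n
  a+k≡n = ⌊n/2⌋+⌈n/2⌉≡n n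
  n∸k≡a : n ∸ k ≡ a
  n∸k≡a = subst (λ m → m ∸ k ≡ a) a+k≡n (m+n∸n≡m a k)
  n≤k+k : n ≤ k + k
  n≤k+k = subst (_≤ k + k) a+k≡n (+-monoˡ-≤ k (⌊n/2⌋≤⌈n/2⌉ n))
  k≤1+a : k ≤ suc a
  k≤1+a = ⌊n/2⌋-mono (n≤1+n (suc n))
  square-double : ∀ m → (m + m) * (m + m) ≡ 4 * (m * m)
  square-double = solve-∀

theorem3 : (n : ℕ) → n ≥ 1 →
    Σ (BN n) λ f → ∀ (h : BN n) → Isomorphic f h → n * n ≤ 9 * numArcs h
theorem3 n _ with S , ∣S∣≡⌈n/2⌉ ← subset-of-size (⌈n/2⌉≤n n) = retraction S , arcs
  where
  arcs : ∀ h → Isomorphic (retraction S) h → n * n ≤ 9 * numArcs h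
  arcs h iso = ≤-trans (n²≤9*⌈n/2⌉*[1+n∸⌈n/2⌉] n)
    (*-monoʳ-≤ 9 (subst (λ k → k * suc (n ∸ k) ≤ numArcs h) ∣S∣≡⌈n/2⌉
                        (ConjugateOfRetraction.k*[1+n∸k]≤numArcs S h iso)))
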